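{- Let $c$ be a complex number and let $(a_n)_{n\ge0},(b_n)_{n\ge0},(d_n)_{n\ge0},(f_n)_{n\ge0}$ be sequences of complex numbers with $a_n\neq 0$ for all $n$. Set $c_n=c$ and $e_n=-1$ for all $n\ge 0$, and suppose that for all $n\ge 0$: $$a_{n+1}=-\frac{a_n^3e_n+a_n^2d_n-a_nc_nb_n+b_n^2}{a_n^2},$$ $$b_{n+1}=-\frac{a_n^4f_n+c_na_n^3d_n-c_n^2a_n^2b_n+2c_na_nb_n^2-b_na_n^2d_n-b_n^3}{a_n^3},$$ $$d_{n+1}=-\frac{ -2a_nc_nb_n+2b_n^2+a_n^2d_n}{a_n^2},\qquad f_{n+1}=-\frac{b_n}{a_n}.$$ Then for all $n\ge 0$, $$a_{n+2}a_{n+1}+a_{n+1}a_n=2a_0a_1+a_0(f_0+f_1+c)(2f_1+c)-\frac{\big(a_0(f_0+f_1+c)\big)^2}{a_{n+1}}.$$ -}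

module Defs where

open import Level using (_⊔_) renaming (suc to lsuc)
open import Algebra.Bundles using (CommutativeRing)
open import Relation.Nullary using (¬_)

-- A field, presented as a commutative ring together with a total
-- inversion operation (the value of 0⁻¹ is irrelevant) that inverts
-- every nonzero element, and with 0 ≠ 1.  (agda-stdlib has no plain
-- Field bundle and no complex numbers.)
record Field c ℓ : Set (lsuc (c ⊔ ℓ)) where
  field
    commutativeRing : CommutativeRing c ℓ
  open CommutativeRing commutativeRing public
  infix 8 _⁻¹
  field
    _⁻¹      : Carrier → Carrier
    ⁻¹-cong  : ∀ {x y} → x ≈ y → x ⁻¹ ≈ y ⁻¹
    inverseʳ : ∀ x → ¬ (x ≈ 0#) → x * x ⁻¹ ≈ 1#
    0≉1      : ¬ (0# ≈ 1#)

  infixl 7 _/_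
  _/_ : Carrier → Carrier → Carrier
  x / y = x * y ⁻¹

-- Since f (n+1) = - b n / a n, eliminating b turns the recursion into a polynomial one under
-- which κ = a n (f n + f (n+1) + c) does not depend on n.  Then
-- a (n+1) (a (n+2) - a n) = κ (f (n+1) - f (n+2)), so τ n = a (n+1) a n + κ f (n+1) is
-- constant as well, and
--   a (n+2) a (n+1) + a (n+1) a n = τ (n+1) + τ n - κ (f (n+1) + f (n+2))
--                                 = 2 τ 0 + κ c - κ² / a (n+1),
-- because κ = a (n+1) (f (n+1) + f (n+2) + c).
module Submission where

open import Defs
open import Algebra.Bundles using (CommutativeRing)
open import Data.Nat as ℕ using (ℕ; zero; suc)
import Data.Nat.Properties as ℕ
open import Data.Integer as ℤ using (ℤ; +_; -[1+_])
import Data.Integer.Properties as ℤ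
open import Data.Sign as Sign using (Sign)
open import Data.Maybe using (Maybe; just; nothing)
open import Relation.Binary.Bundles using (Setoid)
open import Relation.Nullary using (¬_; yes; no)
import Relation.Binary.PropositionalEquality as ≡

module _ {c ℓ} (S : Setoid c ℓ) where
  open Setoid S

  stationary⇒constant : (s : ℕ → Carrier) → (∀ n → s (suc n) ≈ s n) → ∀ n → s n ≈ s 0
  stationary⇒constant s step zero    = refl
  stationary⇒constant s step (suc n) = trans (step n) (stationary⇒constant s step n)

module IntegerCoefficients {c ℓ} (R : CommutativeRing c ℓ) where
  open CommutativeRing R
  open import Algebra.Properties.Ring ring using (-0#≈0#; -‿involutive; -1*x≈-x; -‿distribʳ-*)
  open import Algebra.Properties.AbelianGroup +-abelianGroup using (⁻¹-∙-comm)
  open import Algebra.Properties.CommutativeSemigroup +-commutativeSemigroup using (interchange)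
  open import Algebra.Properties.CommutativeSemigroup *-commutativeSemigroup
    using () renaming (interchange to *-interchange)
  open import Algebra.Properties.Semiring.Mult.TCOptimised semiring using (_×_; 1+×; ×-homo-+; ×1-homo-*)
  open import Algebra.Solver.Ring.AlmostCommutativeRing
    using (AlmostCommutativeRing; fromCommutativeRing; _-Raw-AlmostCommutative⟶_)
  open import Relation.Binary.Reasoning.Setoid setoid

  -- The optimised ℕ-multiple makes fromℤ (+ 2) reduce to 1# + 1#, the statement's two.
  fromℤ : ℤ → Carrier
  fromℤ (+ n)     = n × 1#
  fromℤ -[1+ n ]  = - (suc n × 1#)

  fromℤ-homo-⊖ : ∀ m n → fromℤ (m ℤ.⊖ n) ≈ m × 1# - n × 1#
  fromℤ-homo-⊖ m       zero    = sym (trans (+-congˡ -0#≈0#) (+-identityʳ _))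
  fromℤ-homo-⊖ zero    (suc n) = sym (+-identityˡ _)
  fromℤ-homo-⊖ (suc m) (suc n) rewrite ℤ.[1+m]⊖[1+n]≡m⊖n m n = begin
    fromℤ (m ℤ.⊖ n)                          ≈⟨ fromℤ-homo-⊖ m n ⟩
    m × 1# - n × 1#                          ≈⟨ sym (+-identityˡ _) ⟩
    0# + (m × 1# - n × 1#)                   ≈⟨ +-congʳ (sym (-‿inverseʳ 1#)) ⟩
    (1# - 1#) + (m × 1# - n × 1#)            ≈⟨ interchange _ _ _ _ ⟩
    (1# + m × 1#) + (- 1# - n × 1#)          ≈⟨ +-cong (sym (1+× m 1#)) (⁻¹-∙-comm _ _) ⟩
    suc m × 1# - (1# + n × 1#)               ≈⟨ +-congˡ (-‿cong (sym (1+× n 1#))) ⟩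
    suc m × 1# - suc n × 1#                  ∎

  fromℤ-homo-+ : ∀ i j → fromℤ (i ℤ.+ j) ≈ fromℤ i + fromℤ j
  fromℤ-homo-+ (+ m)    (+ n)    = ×-homo-+ 1# m n
  fromℤ-homo-+ (+ m)    -[1+ n ] = fromℤ-homo-⊖ m (suc n)
  fromℤ-homo-+ -[1+ m ] (+ n)    = trans (fromℤ-homo-⊖ n (suc m)) (+-comm _ _)
  fromℤ-homo-+ -[1+ m ] -[1+ n ] = begin
    - (suc (suc (m ℕ.+ n)) × 1#)      ≡⟨ ≡.cong (λ k → - (suc k × 1#)) (ℕ.+-suc m n) ⟨
    - ((suc m ℕ.+ suc n) × 1#)        ≈⟨ -‿cong (×-homo-+ 1# (suc m) (suc n)) ⟩
    - (suc m × 1# + suc n × 1#)       ≈⟨ ⁻¹-∙-comm _ _ ⟨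
    - (suc m × 1#) - (suc n × 1#)     ∎

  fromℤ-homo-neg : ∀ i → fromℤ (ℤ.- i) ≈ - fromℤ i
  fromℤ-homo-neg (+ zero)  = sym -0#≈0#
  fromℤ-homo-neg (+ suc n) = refl
  fromℤ-homo-neg -[1+ n ]  = sym (-‿involutive _)

  fromSign : Sign → Carrier
  fromSign Sign.+ = 1#
  fromSign Sign.- = - 1#

  fromSign-homo-* : ∀ s t → fromSign (s Sign.* t) ≈ fromSign s * fromSign t
  fromSign-homo-* Sign.+ t      = sym (*-identityˡ _)
  fromSign-homo-* Sign.- Sign.+ = sym (*-identityʳ _)
  fromSign-homo-* Sign.- Sign.- = begin
    1#                ≈⟨ -‿involutive _ ⟨
    - - 1#            ≈⟨ -‿cong (-1*x≈-x 1#) ⟨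
    - (- 1# * 1#)     ≈⟨ -‿distribʳ-* _ _ ⟩
    - 1# * - 1#       ∎

  fromℤ-◃ : ∀ s n → fromℤ (s ℤ.◃ n) ≈ fromSign s * (n × 1#)
  fromℤ-◃ s       zero    = sym (zeroʳ _)
  fromℤ-◃ Sign.+ (suc n) = sym (*-identityˡ _)
  fromℤ-◃ Sign.- (suc n) = sym (-1*x≈-x _)

  fromℤ-sign-abs : ∀ i → fromℤ i ≈ fromSign (ℤ.sign i) * (ℤ.∣ i ∣ × 1#)
  fromℤ-sign-abs (+ n)    = sym (*-identityˡ _)
  fromℤ-sign-abs -[1+ n ] = sym (-1*x≈-x _)

  fromℤ-homo-* : ∀ i j → fromℤ (i ℤ.* j) ≈ fromℤ i * fromℤ j
  fromℤ-homo-* i j = begin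
    fromℤ (i ℤ.* j)
      ≈⟨ fromℤ-◃ (ℤ.sign i Sign.* ℤ.sign j) (ℤ.∣ i ∣ ℕ.* ℤ.∣ j ∣) ⟩
    fromSign (ℤ.sign i Sign.* ℤ.sign j) * ((ℤ.∣ i ∣ ℕ.* ℤ.∣ j ∣) × 1#)
      ≈⟨ *-cong (fromSign-homo-* (ℤ.sign i) (ℤ.sign j)) (×1-homo-* ℤ.∣ i ∣ ℤ.∣ j ∣) ⟩
    (fromSign (ℤ.sign i) * fromSign (ℤ.sign j)) * ((ℤ.∣ i ∣ × 1#) * (ℤ.∣ j ∣ × 1#))
      ≈⟨ *-interchange _ _ _ _ ⟩
    (fromSign (ℤ.sign i) * (ℤ.∣ i ∣ × 1#)) * (fromSign (ℤ.sign j) * (ℤ.∣ j ∣ × 1#))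
      ≈⟨ *-cong (fromℤ-sign-abs i) (fromℤ-sign-abs j) ⟨
    fromℤ i * fromℤ j ∎

  fromℤ-homomorphism : ℤ.+-*-rawRing -Raw-AlmostCommutative⟶ fromCommutativeRing R
  fromℤ-homomorphism = record
    { ⟦_⟧    = fromℤ
    ; +-homo = fromℤ-homo-+
    ; *-homo = fromℤ-homo-*
    ; -‿homo = fromℤ-homo-neg
    ; 0-homo = refl
    ; 1-homo = refl
    }

  fromℤ-≟ : ∀ i j → Maybe (fromℤ i ≈ fromℤ j)
  fromℤ-≟ i j with i ℤ.≟ j
  ... | yes ≡.refl = just refl
  ... | no _       = nothing

  open import Algebra.Solver.Ring ℤ.+-*-rawRing (fromCommutativeRing R) fromℤ-homomorphism fromℤ-≟
    public using (solve; _:=_; _:+_; _:*_; _:-_; :-_; con)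

module FieldProperties {c ℓ} (K : Field c ℓ) where
  open Field K
  open IntegerCoefficients commutativeRing using (solve; _:=_; _:*_)
  open import Relation.Binary.Reasoning.Setoid setoid

  x*y/x≈y : ∀ {x} y → ¬ x ≈ 0# → x * y / x ≈ y
  x*y/x≈y {x} y x≉0 = begin
    x * y * x ⁻¹    ≈⟨ solve 3 (λ x y x⁻¹ → x :* y :* x⁻¹ := y :* (x :* x⁻¹)) refl x y (x ⁻¹) ⟩
    y * (x * x ⁻¹)  ≈⟨ *-congˡ (inverseʳ x x≉0) ⟩
    y * 1#          ≈⟨ *-identityʳ y ⟩
    y               ∎

  x*y≉0 : ∀ {x y} → ¬ x ≈ 0# → ¬ y ≈ 0# → ¬ x * y ≈ 0#
  x*y≉0 {x} {y} x≉0 y≉0 xy≈0 = y≉0 (begin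
    y                ≈⟨ x*y/x≈y y x≉0 ⟨
    x * y * x ⁻¹     ≈⟨ *-congʳ xy≈0 ⟩
    0# * x ⁻¹        ≈⟨ zeroˡ _ ⟩
    0#               ∎)

  /-unique : ∀ {p q r} → ¬ q ≈ 0# → p ≈ q * r → p / q ≈ r
  /-unique {q = q} {r} q≉0 p≈qr = trans (*-congʳ p≈qr) (x*y/x≈y r q≉0)

module Recurrence {ℓc ℓ} (K : Field ℓc ℓ) where
  open Field K
  open FieldProperties K
  open IntegerCoefficients commutativeRing using (solve; _:=_; _:+_; _:*_; _:-_; :-_; con)
  open import Algebra.Properties.Ring ring using (-‿injective; -‿involutive)
  open import Relation.Binary.Reasoning.Setoid setoid

  two : Carrier
  two = 1# + 1#

  module _ (c : Carrier) (a b d f : ℕ → Carrier) (a≉0 : ∀ n → ¬ (a n ≈ 0#))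
    (a-rec : ∀ n → a (suc n) ≈ - ((a n * a n * a n * - 1# + a n * a n * d n - a n * c * b n + b n * b n) / (a n * a n)))
    (b-rec : ∀ n → b (suc n) ≈ - ((a n * a n * a n * a n * f n + c * (a n * a n * a n) * d n - c * c * (a n * a n) * b n + two * c * a n * (b n * b n) - b n * (a n * a n) * d n - b n * b n * b n) / (a n * a n * a n)))
    (d-rec : ∀ n → d (suc n) ≈ - ((- (two * a n * c * b n) + two * (b n * b n) + a n * a n * d n) / (a n * a n)))
    (f-rec : ∀ n → f (suc n) ≈ - (b n / a n)) where

    b≈-f*a : ∀ n → b n ≈ - (f (suc n) * a n)
    b≈-f*a n = begin
      b n                      ≈⟨ x*y/x≈y (b n) (a≉0 n) ⟨
      a n * b n / a n          ≈⟨ solve 3 (λ a b a⁻¹ → a :* b :* a⁻¹ := :- (:- (b :* a⁻¹) :* a)) refl (a n) (b n) (a n ⁻¹) ⟩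
      - (- (b n / a n) * a n)  ≈⟨ -‿cong (*-congʳ (f-rec n)) ⟨
      - (f (suc n) * a n)      ∎

    a-step : ∀ n → let g = f (suc n) in a (suc n) ≈ a n - d n - c * g - g * g
    a-step n = trans (a-rec n) (trans (-‿cong (/-unique (x*y≉0 (a≉0 n) (a≉0 n)) numerator)) (-‿involutive _))
      where
      g = f (suc n)
      β = b≈-f*a n
      numerator : a n * a n * a n * - 1# + a n * a n * d n - a n * c * b n + b n * b n
                ≈ a n * a n * - (a n - d n - c * g - g * g)
      numerator = begin
        a n * a n * a n * - 1# + a n * a n * d n - a n * c * b n + b n * b n
          ≈⟨ +-cong (+-congˡ (-‿cong (*-congˡ β))) (*-cong β β) ⟩
        a n * a n * a n * - 1# + a n * a n * d n - a n * c * - (g * a n) + - (g * a n) * - (g * a n)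
          ≈⟨ solve 4 (λ a d c g → a :* a :* a :* (:- con (+ 1)) :+ a :* a :* d :- a :* c :* (:- (g :* a)) :+ (:- (g :* a)) :* (:- (g :* a))
                               := a :* a :* (:- (a :- d :- c :* g :- g :* g))) refl (a n) (d n) c g ⟩
        a n * a n * - (a n - d n - c * g - g * g) ∎

    d-step : ∀ n → let g = f (suc n) in d (suc n) ≈ - (two * c * g + two * (g * g) + d n)
    d-step n = trans (d-rec n) (-‿cong (/-unique (x*y≉0 (a≉0 n) (a≉0 n)) numerator))
      where
      g = f (suc n)
      β = b≈-f*a n
      numerator : - (two * a n * c * b n) + two * (b n * b n) + a n * a n * d n
                ≈ a n * a n * (two * c * g + two * (g * g) + d n)
      numerator = begin
        - (two * a n * c * b n) + two * (b n * b n) + a n * a n * d n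
          ≈⟨ +-congʳ (+-cong (-‿cong (*-congˡ β)) (*-congˡ (*-cong β β))) ⟩
        - (two * a n * c * - (g * a n)) + two * (- (g * a n) * - (g * a n)) + a n * a n * d n
          ≈⟨ solve 4 (λ a d c g → :- (con (+ 2) :* a :* c :* (:- (g :* a))) :+ con (+ 2) :* ((:- (g :* a)) :* (:- (g :* a))) :+ a :* a :* d
                               := a :* a :* (con (+ 2) :* c :* g :+ con (+ 2) :* (g :* g) :+ d)) refl (a n) (d n) c g ⟩
        a n * a n * (two * c * g + two * (g * g) + d n) ∎

    f-step : ∀ n → let g = f (suc n) in
             f (suc (suc n)) * a (suc n) ≈ a n * f n + c * d n + c * c * g + two * c * (g * g) + g * d n + g * g * g
    f-step n = -‿injective (begin
      - (f (suc (suc n)) * a (suc n))  ≈⟨ b≈-f*a (suc n) ⟨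
      b (suc n)                       ≈⟨ b-rec n ⟩
      - (_ / (a n * a n * a n))       ≈⟨ -‿cong (/-unique (x*y≉0 (x*y≉0 (a≉0 n) (a≉0 n)) (a≉0 n)) numerator) ⟩
      - Y                             ∎)
      where
      g = f (suc n)
      β = b≈-f*a n
      Y = a n * f n + c * d n + c * c * g + two * c * (g * g) + g * d n + g * g * g
      numerator : a n * a n * a n * a n * f n + c * (a n * a n * a n) * d n - c * c * (a n * a n) * b n
                  + two * c * a n * (b n * b n) - b n * (a n * a n) * d n - b n * b n * b n
                ≈ a n * a n * a n * Y
      numerator = begin
        a n * a n * a n * a n * f n + c * (a n * a n * a n) * d n - c * c * (a n * a n) * b n
          + two * c * a n * (b n * b n) - b n * (a n * a n) * d n - b n * b n * b n
          ≈⟨ +-cong (+-cong (+-cong (+-congˡ (-‿cong (*-congˡ β))) (*-congˡ (*-cong β β))) (-‿cong (*-congʳ (*-congʳ β))))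
                    (-‿cong (*-cong (*-cong β β) β)) ⟩
        a n * a n * a n * a n * f n + c * (a n * a n * a n) * d n - c * c * (a n * a n) * - (g * a n)
          + two * c * a n * (- (g * a n) * - (g * a n)) - - (g * a n) * (a n * a n) * d n - - (g * a n) * - (g * a n) * - (g * a n)
          ≈⟨ solve 5 (λ a f d c g →
                a :* a :* a :* a :* f :+ c :* (a :* a :* a) :* d :- c :* c :* (a :* a) :* (:- (g :* a))
                  :+ con (+ 2) :* c :* a :* ((:- (g :* a)) :* (:- (g :* a))) :- (:- (g :* a)) :* (a :* a) :* d
                  :- (:- (g :* a)) :* (:- (g :* a)) :* (:- (g :* a))
                := a :* a :* a :* (a :* f :+ c :* d :+ c :* c :* g :+ con (+ 2) :* c :* (g :* g) :+ g :* d :+ g :* g :* g))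
                refl (a n) (f n) (d n) c g ⟩
        a n * a n * a n * Y ∎

    κ : ℕ → Carrier
    κ n = a n * (f n + f (suc n) + c)

    κ-step : ∀ n → κ (suc n) ≈ κ n
    κ-step n = begin
      a (suc n) * (g + g′ + c)
        ≈⟨ solve 4 (λ a′ g g′ c → a′ :* (g :+ g′ :+ c) := a′ :* (g :+ c) :+ g′ :* a′) refl (a (suc n)) g g′ c ⟩
      a (suc n) * (g + c) + g′ * a (suc n)
        ≈⟨ +-cong (*-congʳ (a-step n)) (f-step n) ⟩
      (a n - d n - c * g - g * g) * (g + c) + (a n * f n + c * d n + c * c * g + two * c * (g * g) + g * d n + g * g * g)
        ≈⟨ solve 5 (λ a f d c g → (a :- d :- c :* g :- g :* g) :* (g :+ c)
                                   :+ (a :* f :+ c :* d :+ c :* c :* g :+ con (+ 2) :* c :* (g :* g) :+ g :* d :+ g :* g :* g)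
                                 := a :* (f :+ g :+ c)) refl (a n) (f n) (d n) c g ⟩
      a n * (f n + g + c) ∎
      where
      g  = f (suc n)
      g′ = f (suc (suc n))

    κ≈κ₀ : ∀ n → κ n ≈ κ 0
    κ≈κ₀ = stationary⇒constant setoid κ κ-step

    a-gap : ∀ n → a (suc n) * (a (suc (suc n)) - a n) ≈ κ 0 * (f (suc n) - f (suc (suc n)))
    a-gap n = begin
      a (suc n) * (a (suc (suc n)) - a n)
        ≈⟨ *-congˡ (+-congʳ (a-step (suc n))) ⟩
      a (suc n) * ((a (suc n) - d (suc n) - c * g′ - g′ * g′) - a n)
        ≈⟨ *-congˡ (+-congʳ (+-congʳ (+-congʳ (+-cong (a-step n) (-‿cong (d-step n)))))) ⟩
      a (suc n) * (((a n - d n - c * g - g * g) - - (two * c * g + two * (g * g) + d n) - c * g′ - g′ * g′) - a n)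
        ≈⟨ *-congˡ (solve 5 (λ a d c g g′ → ((a :- d :- c :* g :- g :* g) :- :- (con (+ 2) :* c :* g :+ con (+ 2) :* (g :* g) :+ d)
                                              :- c :* g′ :- g′ :* g′) :- a
                                            := (g :+ g′ :+ c) :* (g :- g′)) refl (a n) (d n) c g g′) ⟩
      a (suc n) * ((g + g′ + c) * (g - g′))
        ≈⟨ *-assoc _ _ _ ⟨
      κ (suc n) * (g - g′)
        ≈⟨ *-congʳ (κ≈κ₀ (suc n)) ⟩
      κ 0 * (g - g′) ∎
      where
      g  = f (suc n)
      g′ = f (suc (suc n))

    τ : ℕ → Carrier
    τ n = a (suc n) * a n + κ 0 * f (suc n)

    τ-step : ∀ n → τ (suc n) ≈ τ n
    τ-step n = begin
      τ (suc n)
        ≈⟨ solve 6 (λ a₀ a₁ a₂ g g′ k → a₂ :* a₁ :+ k :* g′ := a₁ :* a₀ :+ k :* g :+ (a₁ :* (a₂ :- a₀) :- k :* (g :- g′)))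
                   refl (a n) (a (suc n)) (a (suc (suc n))) (f (suc n)) (f (suc (suc n))) (κ 0) ⟩
      τ n + (a (suc n) * (a (suc (suc n)) - a n) - κ 0 * (f (suc n) - f (suc (suc n))))
        ≈⟨ +-congˡ (trans (+-congʳ (a-gap n)) (-‿inverseʳ _)) ⟩
      τ n + 0#
        ≈⟨ +-identityʳ _ ⟩
      τ n ∎

    τ≈τ₀ : ∀ n → τ n ≈ τ 0
    τ≈τ₀ = stationary⇒constant setoid τ τ-step

    κ₀-factor : ∀ n → κ 0 * κ 0 / a (suc n) ≈ κ 0 * (f (suc n) + f (suc (suc n)) + c)
    κ₀-factor n = begin
      κ 0 * κ 0 / a (suc n)            ≈⟨ *-congʳ (*-congˡ (κ≈κ₀ (suc n))) ⟨
      κ 0 * (a (suc n) * h) / a (suc n) ≈⟨ *-congʳ (x*y*z≈y*[x*z]) ⟩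
      a (suc n) * (κ 0 * h) / a (suc n) ≈⟨ x*y/x≈y _ (a≉0 (suc n)) ⟩
      κ 0 * h                          ∎
      where
      h = f (suc n) + f (suc (suc n)) + c
      x*y*z≈y*[x*z] : κ 0 * (a (suc n) * h) ≈ a (suc n) * (κ 0 * h)
      x*y*z≈y*[x*z] = solve 3 (λ k a h → k :* (a :* h) := a :* (k :* h)) refl (κ 0) (a (suc n)) h

    a-sum : ∀ n → a (suc (suc n)) * a (suc n) + a (suc n) * a n
                  ≈ two * a 0 * a 1 + κ 0 * (two * f 1 + c) - κ 0 * κ 0 / a (suc n)
    a-sum n = begin
      a (suc (suc n)) * a (suc n) + a (suc n) * a n
        ≈⟨ solve 7 (λ a₀ a₁ a₂ g g′ k c → a₂ :* a₁ :+ a₁ :* a₀ := (a₂ :* a₁ :+ k :* g′) :+ (a₁ :* a₀ :+ k :* g) :+ k :* c :- k :* (g :+ g′ :+ c))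
                   refl (a n) (a (suc n)) (a (suc (suc n))) (f (suc n)) (f (suc (suc n))) (κ 0) c ⟩
      τ (suc n) + τ n + κ 0 * c - κ 0 * (f (suc n) + f (suc (suc n)) + c)
        ≈⟨ +-cong (+-congʳ (+-cong (τ≈τ₀ (suc n)) (τ≈τ₀ n))) (-‿cong (sym (κ₀-factor n))) ⟩
      τ 0 + τ 0 + κ 0 * c - κ 0 * κ 0 / a (suc n)
        ≈⟨ solve 6 (λ a₀ a₁ g k c q → (a₁ :* a₀ :+ k :* g) :+ (a₁ :* a₀ :+ k :* g) :+ k :* c :- q
                                      := con (+ 2) :* a₀ :* a₁ :+ k :* (con (+ 2) :* g :+ c) :- q)
                   refl (a 0) (a 1) (f 1) (κ 0) c (κ 0 * κ 0 / a (suc n)) ⟩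
      two * a 0 * a 1 + κ 0 * (two * f 1 + c) - κ 0 * κ 0 / a (suc n) ∎

theorem2p2 : ∀ {ℓc ℓ} (K : Field ℓc ℓ) → let open Field K in
    (c : Carrier) (a b d f : ℕ → Carrier) →
    (∀ n → ¬ (a n ≈ 0#)) →
    let cₙ : ℕ → Carrier
        cₙ = λ _ → c
        eₙ : ℕ → Carrier
        eₙ = λ _ → - 1#
        two : Carrier
        two = 1# + 1#
    in
    (∀ n → a (suc n) ≈ - ((a n * a n * a n * eₙ n + a n * a n * d n - a n * cₙ n * b n + b n * b n) / (a n * a n))) →
    (∀ n → b (suc n) ≈ - ((a n * a n * a n * a n * f n + cₙ n * (a n * a n * a n) * d n - cₙ n * cₙ n * (a n * a n) * b n + two * cₙ n * a n * (b n * b n) - b n * (a n * a n) * d n - b n * b n * b n) / (a n * a n * a n))) →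
    (∀ n → d (suc n) ≈ - ((- (two * a n * cₙ n * b n) + two * (b n * b n) + a n * a n * d n) / (a n * a n))) →
    (∀ n → f (suc n) ≈ - (b n / a n)) →
    ∀ n → a (suc (suc n)) * a (suc n) + a (suc n) * a n
          ≈ two * a 0 * a 1 + a 0 * (f 0 + f 1 + c) * (two * f 1 + c)
            - (a 0 * (f 0 + f 1 + c)) * (a 0 * (f 0 + f 1 + c)) / a (suc n)
theorem2p2 K = Recurrence.a-sum K
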